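{- Let $G$ be a finite simple graph of order $n\geq 6$ with minimum degree $\delta(G)$. If $\delta(G)\geq\lceil n/2\rceil+1$, then $G$ has a fort of cardinality less than $\lfloor n/2\rfloor$. Similarly, if $\delta(G)\geq\lfloor n/2\rfloor+1$, then $G$ has a fort of cardinality less than $\lceil n/2\rceil$.
   Context: A fort of a finite simple graph $G=(V,E)$ is a non-empty subset $F\subseteq V$ such that no vertex $u\in V\setminus F$ has exactly one neighbor in $F$. -}

module Defs where

open import Data.Nat using (ℕ; _≤_)
open import Data.Bool using (Bool; true; false)
open import Data.Fin using (Fin)
open import Data.Fin.Subset using (Subset; _∈_; _∉_; _∩_; ∣_∣; Nonempty)
open import Data.Vec using (tabulate)
open import Data.Product using (_×_)
open import Relation.Binary.PropositionalEquality using (_≡_; _≢_)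

record Graph (n : ℕ) : Set where
  field
    adj   : Fin n → Fin n → Bool
    sym   : ∀ u v → adj u v ≡ adj v u
    irrefl : ∀ v → adj v v ≡ false

open Graph public

N : ∀ {n} → Graph n → Fin n → Subset n
N G v = tabulate (adj G v)

degree : ∀ {n} → Graph n → Fin n → ℕ
degree G v = ∣ N G v ∣

MinDegreeAtLeast : ∀ {n} → Graph n → ℕ → Set
MinDegreeAtLeast G k = ∀ v → k ≤ degree G v

IsFort : ∀ {n} → Graph n → Subset n → Set
IsFort G F = Nonempty F × (∀ u → u ∉ F → ∣ N G u ∩ F ∣ ≢ 1)

{-# OPTIONS --safe #-}
-- Take a vertex v of minimum degree. Its non-neighbourhood V ∖ N(v) contains v
-- and has n − deg v elements; it is a fort unless some neighbour u of v has v as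
-- its only neighbour outside N(v), i.e. N[u] ⊆ N[v]. Then deg u ≥ deg v forces
-- N[u] = N[v], and {u, v} is a fort: every other vertex sees both or neither.
module Submission where

open import Defs hiding (sym)
open import Data.Nat using (ℕ; suc; _≤_; _<_; _+_; _∸_; ⌊_/2⌋; ⌈_/2⌉; z≤n; s≤s)
open import Data.Nat.Properties
open import Data.Bool using (true)
open import Data.Fin using (Fin; zero; suc) renaming (_≟_ to _≟ᶠ_)
open import Data.Fin.Properties using (any?)
open import Data.Fin.Subset using (Subset; inside; outside; ⁅_⁆; ∁; _∪_; _∩_; _-_; _∈_; _∉_; _⊆_; ∣_∣; Nonempty)
open import Data.Fin.Subset.Properties
open import Data.List using (allFin)
import Data.List.Relation.Unary.All as All
open import Data.List.Membership.Propositional.Properties using (∈-allFin)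
open import Data.List.Extrema.Nat using (argmin; f[argmin]≤f[xs])
open import Data.Product using (_×_; ∃; _,_; map; map₂)
open import Data.Sum as Sum using (_⊎_; inj₁; inj₂)
open import Data.Vec using (_∷_; []; here; there)
open import Data.Vec.Properties using (lookup∘tabulate; []=⇒lookup; lookup⇒[]=)
open import Function using (_∘_)
open import Relation.Nullary using (yes; no; contradiction)
open import Relation.Nullary.Decidable using (_×-dec_)
open import Relation.Binary.PropositionalEquality

private variable
  n : ℕ

∣p∪q∣≤∣p∣+∣q∣ : ∀ (p q : Subset n) → ∣ p ∪ q ∣ ≤ ∣ p ∣ + ∣ q ∣
∣p∪q∣≤∣p∣+∣q∣ []            []            = z≤n
∣p∪q∣≤∣p∣+∣q∣ (inside  ∷ p) (s       ∷ q) =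
  s≤s (≤-trans (∣p∪q∣≤∣p∣+∣q∣ p q) (+-monoʳ-≤ ∣ p ∣ (∣p∣≤∣x∷p∣ s q)))
∣p∪q∣≤∣p∣+∣q∣ (outside ∷ p) (inside  ∷ q) =
  ≤-trans (s≤s (∣p∪q∣≤∣p∣+∣q∣ p q)) (≤-reflexive (sym (+-suc ∣ p ∣ ∣ q ∣)))
∣p∪q∣≤∣p∣+∣q∣ (outside ∷ p) (outside ∷ q) = ∣p∪q∣≤∣p∣+∣q∣ p q

∣⁅x⁆∪⁅y⁆∣≤2 : ∀ (x y : Fin n) → ∣ ⁅ x ⁆ ∪ ⁅ y ⁆ ∣ ≤ 2
∣⁅x⁆∪⁅y⁆∣≤2 x y = ≤-trans (∣p∪q∣≤∣p∣+∣q∣ ⁅ x ⁆ ⁅ y ⁆)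
  (≤-reflexive (cong₂ _+_ (∣⁅x⁆∣≡1 x) (∣⁅x⁆∣≡1 y)))

0<∣p∣⇒Nonempty : ∀ {p : Subset n} → 0 < ∣ p ∣ → Nonempty p
0<∣p∣⇒Nonempty {p = inside  ∷ p} _     = zero , here
0<∣p∣⇒Nonempty {p = outside ∷ p} 0<∣p∣ = map suc there (0<∣p∣⇒Nonempty 0<∣p∣)

∣p∣≤1⇒x≡y : ∀ {p : Subset n} {x y} → ∣ p ∣ ≤ 1 → x ∈ p → y ∈ p → x ≡ y
∣p∣≤1⇒x≡y {p = p} {x} {y} ∣p∣≤1 x∈p y∈p with x ≟ᶠ y
... | yes x≡y = x≡y
... | no  x≢y = contradiction (begin-strict
  1              ≤⟨ <-≤-trans (s≤s z≤n) (x∈p⇒∣p-x∣<∣p∣ y∈p-x) ⟩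
  ∣ p - x ∣      <⟨ x∈p⇒∣p-x∣<∣p∣ x∈p ⟩
  ∣ p ∣          ≤⟨ ∣p∣≤1 ⟩
  1              ∎) (<-irrefl refl)
  where
  open ≤-Reasoning
  y∈p-x : y ∈ p - x
  y∈p-x = x∈p∧x≢y⇒x∈p-y y∈p (x≢y ∘ sym)

module _ (G : Graph n) where

  ∈N⁺ : ∀ {v w} → adj G v w ≡ true → w ∈ N G v
  ∈N⁺ {v} {w} e = lookup⇒[]= w (N G v) (trans (lookup∘tabulate (adj G v) w) e)

  ∈N⁻ : ∀ {v w} → w ∈ N G v → adj G v w ≡ true
  ∈N⁻ {v} {w} w∈Nv = trans (sym (lookup∘tabulate (adj G v) w)) ([]=⇒lookup w∈Nv)

  N-sym : ∀ {v w} → w ∈ N G v → v ∈ N G w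
  N-sym {v} {w} w∈Nv = ∈N⁺ (trans (Graph.sym G w v) (∈N⁻ w∈Nv))

  v∉Nv : ∀ v → v ∉ N G v
  v∉Nv v v∈Nv with () ← trans (sym (irrefl G v)) (∈N⁻ v∈Nv)

  -- N(u) ⊆ N(v) ∪ {v}; for adjacent u and v this is N[u] ⊆ N[v].
  Dominates : Fin n → Fin n → Set
  Dominates v u = ∀ {w} → w ≢ v → w ∈ N G u → w ∈ N G v

  dominates-if-one-outside-neighbour : ∀ {u v} → v ∈ N G u →
    ∣ N G u ∩ ∁ (N G v) ∣ ≤ 1 → Dominates v u
  dominates-if-one-outside-neighbour {u} {v} v∈Nu size≤1 {w} w≢v w∈Nu with w ∈? N G v
  ... | yes w∈Nv = w∈Nv
  ... | no  w∉Nv = contradiction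
    (∣p∣≤1⇒x≡y size≤1 (x∈p∩q⁺ (w∈Nu , x∉p⇒x∈∁p w∉Nv)) (x∈p∩q⁺ (v∈Nu , x∉p⇒x∈∁p (v∉Nv v))))
    w≢v

  dominates-converse-if-degree≤ : ∀ {u v} → u ∈ N G v → Dominates v u →
    degree G v ≤ degree G u → Dominates u v
  dominates-converse-if-degree≤ {u} {v} u∈Nv v≽u deg-v≤deg-u {w} w≢u w∈Nv with w ∈? N G u
  ... | yes w∈Nu = w∈Nu
  ... | no  w∉Nu = contradiction (begin-strict
      ∣ N G v ∣                       ≤⟨ deg-v≤deg-u ⟩
      ∣ N G u ∣                       ≤⟨ p⊆q⇒∣p∣≤∣q∣ Nu⊆v∪Nv-u-w ⟩
      ∣ ⁅ v ⁆ ∪ (N G v - u - w) ∣     ≤⟨ ∣p∪q∣≤∣p∣+∣q∣ ⁅ v ⁆ _ ⟩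
      ∣ ⁅ v ⁆ ∣ + ∣ N G v - u - w ∣   ≡⟨ cong (_+ ∣ N G v - u - w ∣) (∣⁅x⁆∣≡1 v) ⟩
      suc ∣ N G v - u - w ∣           ≤⟨ x∈p⇒∣p-x∣<∣p∣ (x∈p∧x≢y⇒x∈p-y w∈Nv w≢u) ⟩
      ∣ N G v - u ∣                   <⟨ x∈p⇒∣p-x∣<∣p∣ u∈Nv ⟩
      ∣ N G v ∣                       ∎) (<-irrefl refl)
    where
    open ≤-Reasoning
    Nu⊆v∪Nv-u-w : N G u ⊆ ⁅ v ⁆ ∪ (N G v - u - w)
    Nu⊆v∪Nv-u-w {x} x∈Nu with x ≟ᶠ v
    ... | yes refl = x∈p∪q⁺ (inj₁ (x∈⁅x⁆ v))
    ... | no  x≢v  = x∈p∪q⁺ (inj₂ (x∈p∧x≢y⇒x∈p-y (x∈p∧x≢y⇒x∈p-y (v≽u x≢v x∈Nu) x≢u) x≢w))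
      where
      x≢u : x ≢ u
      x≢u refl = v∉Nv x x∈Nu
      x≢w : x ≢ w
      x≢w refl = w∉Nu x∈Nu

  mutually-dominating⇒fort : ∀ {u v} → u ≢ v → Dominates v u → Dominates u v →
    IsFort G (⁅ u ⁆ ∪ ⁅ v ⁆)
  mutually-dominating⇒fort {u} {v} u≢v v≽u u≽v = (u , u∈uv) , one-neighbour-impossible
    where
    u∈uv : u ∈ ⁅ u ⁆ ∪ ⁅ v ⁆
    u∈uv = x∈p∪q⁺ (inj₁ (x∈⁅x⁆ u))
    v∈uv : v ∈ ⁅ u ⁆ ∪ ⁅ v ⁆
    v∈uv = x∈p∪q⁺ (inj₂ (x∈⁅x⁆ v))

    one-neighbour-impossible : ∀ w → w ∉ ⁅ u ⁆ ∪ ⁅ v ⁆ → ∣ N G w ∩ (⁅ u ⁆ ∪ ⁅ v ⁆) ∣ ≢ 1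
    one-neighbour-impossible w w∉uv size≡1 =
      let u∈Nw , v∈Nw = u∈Nw×v∈Nw in
      u≢v (∣p∣≤1⇒x≡y (≤-reflexive size≡1) (x∈p∩q⁺ (u∈Nw , u∈uv)) (x∈p∩q⁺ (v∈Nw , v∈uv)))
      where
      w≢u : w ≢ u
      w≢u refl = w∉uv u∈uv
      w≢v : w ≢ v
      w≢v refl = w∉uv v∈uv

      neighbour-in-uv : ∃ λ x → x ∈ N G w × x ∈ ⁅ u ⁆ ∪ ⁅ v ⁆
      neighbour-in-uv with x , x∈ ← 0<∣p∣⇒Nonempty (≤-reflexive (sym size≡1)) =
        x , x∈p∩q⁻ (N G w) _ x∈

      u∈Nw×v∈Nw : u ∈ N G w × v ∈ N G w
      u∈Nw×v∈Nw with x , x∈Nw , x∈uv ← neighbour-in-uv | x∈p∪q⁻ ⁅ u ⁆ ⁅ v ⁆ x∈uv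
      ... | inj₁ x∈⁅u⁆ rewrite x∈⁅y⁆⇒x≡y u x∈⁅u⁆ = x∈Nw , N-sym (v≽u w≢v (N-sym x∈Nw))
      ... | inj₂ x∈⁅v⁆ rewrite x∈⁅y⁆⇒x≡y v x∈⁅v⁆ = N-sym (u≽v w≢u (N-sym x∈Nw)) , x∈Nw

  minimum-degree-vertex : Fin n → ∃ λ v → ∀ w → degree G v ≤ degree G w
  minimum-degree-vertex v₀ = argmin (degree G) v₀ (allFin _) ,
    λ w → All.lookup (f[argmin]≤f[xs] v₀ (allFin _)) (∈-allFin w)

  ∁N-isFort⊎one-outside-neighbour : ∀ v → IsFort G (∁ (N G v)) ⊎
    ∃ λ u → u ∈ N G v × ∣ N G u ∩ ∁ (N G v) ∣ ≡ 1
  ∁N-isFort⊎one-outside-neighbour v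
    with any? (λ u → (u ∈? N G v) ×-dec (∣ N G u ∩ ∁ (N G v) ∣ ≟ 1))
  ... | yes witness = inj₂ witness
  ... | no  none    = inj₁ ((v , x∉p⇒x∈∁p (v∉Nv v)) ,
    λ u u∉∁Nv size≡1 → none (u , x∉∁p⇒x∈p u∉∁Nv , size≡1))

  fort-of-size≤2-or-n∸degree : ∀ v → (∀ w → degree G v ≤ degree G w) →
    ∃ λ F → IsFort G F × (∣ F ∣ ≤ 2 ⊎ ∣ F ∣ ≡ n ∸ degree G v)
  fort-of-size≤2-or-n∸degree v v-min with ∁N-isFort⊎one-outside-neighbour v
  ... | inj₁ ∁Nv-fort = ∁ (N G v) , ∁Nv-fort , inj₂ (∣∁p∣≡n∸∣p∣ (N G v))
  ... | inj₂ (u , u∈Nv , size≡1) = ⁅ u ⁆ ∪ ⁅ v ⁆ , uv-fort , inj₁ (∣⁅x⁆∪⁅y⁆∣≤2 u v)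
    where
    u≢v : u ≢ v
    u≢v refl = v∉Nv u u∈Nv
    v≽u : Dominates v u
    v≽u = dominates-if-one-outside-neighbour (N-sym u∈Nv) (≤-reflexive size≡1)
    uv-fort : IsFort G (⁅ u ⁆ ∪ ⁅ v ⁆)
    uv-fort = mutually-dominating⇒fort u≢v v≽u
      (dominates-converse-if-degree≤ u∈Nv v≽u (v-min u))

  fort-of-size≤2-or-n∸δ : ∀ {d} → Fin n → MinDegreeAtLeast G d →
    ∃ λ F → IsFort G F × (∣ F ∣ ≤ 2 ⊎ ∣ F ∣ ≤ n ∸ d)
  fort-of-size≤2-or-n∸δ v₀ δ≥d =
    let v , v-min = minimum-degree-vertex v₀
        F , F-fort , small = fort-of-size≤2-or-n∸degree v v-min
    in F , F-fort , Sum.map₂ (λ ∣F∣≡ → ≤-trans (≤-reflexive ∣F∣≡) (∸-monoʳ-≤ n (δ≥d v))) small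

m≤2⊎m≤t+c∸[c+1]⇒m<t : ∀ {m c t} → 3 ≤ t → m ≤ 2 ⊎ m ≤ t + c ∸ (c + 1) → m < t
m≤2⊎m≤t+c∸[c+1]⇒m<t 3≤t (inj₁ m≤2) = ≤-trans (s≤s m≤2) 3≤t
m≤2⊎m≤t+c∸[c+1]⇒m<t {m} {c} {suc t} _ (inj₂ m≤t+c∸[c+1]) = begin-strict
  m                    ≤⟨ m≤t+c∸[c+1] ⟩
  suc t + c ∸ (c + 1)  ≡⟨ sym (∸-+-assoc (suc t + c) c 1) ⟩
  suc t + c ∸ c ∸ 1    ≡⟨ cong (_∸ 1) (m+n∸n≡m (suc t) c) ⟩
  t                    <⟨ n<1+n t ⟩
  suc t                ∎
  where open ≤-Reasoning

fort-smaller-than : ∀ {c t} (G : Graph n) → 3 ≤ t → t + c ≡ n →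
  MinDegreeAtLeast G (c + 1) → ∃ λ F → IsFort G F × ∣ F ∣ < t
fort-smaller-than {c = c} {t = suc _} G 3≤t refl δ≥c+1 =
  map₂ (map₂ (m≤2⊎m≤t+c∸[c+1]⇒m<t {c = c} 3≤t)) (fort-of-size≤2-or-n∸δ G zero δ≥c+1)

theorem3p3 : ∀ (n : ℕ) → 6 ≤ n → (G : Graph n) →
    (MinDegreeAtLeast G (⌈ n /2⌉ + 1) → ∃ λ (F : Subset n) → IsFort G F × ∣ F ∣ < ⌊ n /2⌋)
    × (MinDegreeAtLeast G (⌊ n /2⌋ + 1) → ∃ λ (F : Subset n) → IsFort G F × ∣ F ∣ < ⌈ n /2⌉)
theorem3p3 n 6≤n G =
  fort-smaller-than G 3≤⌊n/2⌋ (⌊n/2⌋+⌈n/2⌉≡n n) ,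
  fort-smaller-than G (≤-trans 3≤⌊n/2⌋ (⌊n/2⌋≤⌈n/2⌉ n)) (trans (+-comm ⌈ n /2⌉ ⌊ n /2⌋) (⌊n/2⌋+⌈n/2⌉≡n n))
  where
  3≤⌊n/2⌋ : 3 ≤ ⌊ n /2⌋
  3≤⌊n/2⌋ = ⌊n/2⌋-mono 6≤n
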